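{- Let $G$ be a graph containing at least one pendent edge. If $H$ is a graph obtained from $G$ by successively deleting $k$ pendent edges (each being a pendent edge of the current graph at the time of its deletion), then $\mathrm{czf}(G)=\mathrm{czf}(H)+k$.
   Context: All graphs are finite and simple. A pendent edge is an edge $e=uv$ at least one of whose endpoints has degree $1$. Deleting a pendent edge $e=uv$ means removing $e$ together with both endpoints $u$ and $v$. Constrained zero forcing: start with a set $S\subseteq V(G)$ of colored vertices, all others uncolored. A colored vertex $c$ may force an uncolored vertex $u$ to become colored if $u$ is the only uncolored neighbor of $c$; only vertices of the initial set $S$ may ever force. $S$ is a constrained zero forcing set if some sequence of forces colors all vertices. $\mathrm{czf}(G)$ is the minimum size of a constrained zero forcing set ($0$ for the graph with no vertices). -}

module Defs where

open import Data.Nat using (ℕ; zero; suc; _≤_; _+_)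
open import Data.Bool using (Bool; true; false)
open import Data.Fin using (Fin)
open import Data.Fin.Subset using (Subset; _∈_; _∉_; _⊆_; _∩_; _∪_; ⁅_⁆; ∣_∣; ⊤; _-_)
open import Data.Vec using (tabulate)
open import Data.Product using (Σ; _×_)
open import Data.Sum using (_⊎_)
open import Relation.Binary.PropositionalEquality using (_≡_)
open import Relation.Binary.Construct.Closure.ReflexiveTransitive using (Star)

record Graph (n : ℕ) : Set where
  field
    adj    : Fin n → Fin n → Bool
    adjSym : ∀ u v → adj u v ≡ adj v u
    adjIrr : ∀ v → adj v v ≡ false
open Graph public

Adj : ∀ {n} → Graph n → Fin n → Fin n → Set
Adj G u v = adj G u v ≡ true

nbhd : ∀ {n} → Graph n → Fin n → Subset n
nbhd G v = tabulate (λ w → adj G v w)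

-- Degree of v in the induced subgraph G[W].
deg : ∀ {n} → Graph n → Subset n → Fin n → ℕ
deg G W v = ∣ nbhd G v ∩ W ∣

PendentEdge : ∀ {n} → Graph n → Subset n → Fin n → Fin n → Set
PendentEdge G W u v =
  u ∈ W × v ∈ W × Adj G u v × (deg G W u ≡ 1 ⊎ deg G W v ≡ 1)

-- Deleting the pendent edge uv: remove both endpoints.
delEdge : ∀ {n} → Subset n → Fin n → Fin n → Subset n
delEdge W u v = (W - u) - v

data DeleteSeq {n : ℕ} (G : Graph n) : Subset n → ℕ → Subset n → Set where
  done : ∀ {W} → DeleteSeq G W 0 W
  step : ∀ {W W' k} (u v : Fin n) → PendentEdge G W u v →
         DeleteSeq G (delEdge W u v) k W' → DeleteSeq G W (suc k) W'

-- One constrained force in G[W] with initial set S: a colored vertex c ∈ S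
-- forces its unique uncolored neighbour u (within W); C is the colored set.
data Force {n : ℕ} (G : Graph n) (W S : Subset n) : Subset n → Subset n → Set where
  force : ∀ {C} (c u : Fin n) → c ∈ S → c ∈ C → u ∈ W → u ∉ C → Adj G c u →
          (∀ w → w ∈ W → Adj G c w → w ∉ C → w ≡ u) →
          Force G W S C (⁅ u ⁆ ∪ C)

IsCZFS : ∀ {n} → Graph n → Subset n → Subset n → Set
IsCZFS G W S = S ⊆ W × Star (Force G W S) S W

CzfIs : ∀ {n} → Graph n → Subset n → ℕ → Set
CzfIs G W m =
  Σ (Subset _) (λ S → IsCZFS G W S × ∣ S ∣ ≡ m) ×
  (∀ S → IsCZFS G W S → m ≤ ∣ S ∣)

{-# OPTIONS --safe #-}
module Submission where

-- Let u be a leaf with stem v.  A constrained zero forcing set of G - u - v becomes one of G by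
-- adding u, which forces v first; afterwards u and v are coloured and every old force stays valid.
-- Conversely, take a constrained zero forcing set S of G.  The leaf is coloured only if u ∈ S or
-- v forces it, and v forces at most once, since afterwards all its neighbours are coloured.  Drop
-- u and v from S and, if v forces some w ≠ u (so that u, v ∈ S), add w: every remaining force of
-- the chain can be replayed in G - u - v, and the new set is smaller than S by at least one.

open import Defs
open import Level using (Level; _⊔_)
open import Data.Nat using (ℕ; suc; _+_; _≤_; _<_; z≤n; s≤s)
open import Data.Nat.Properties
  using (≤-trans; ≤-reflexive; ≤-<-trans; <-≤-trans; ≤-antisym; +-suc; +-identityʳ; +-monoˡ-≤; +-monoʳ-≤;
         m≤m+n; n≤1+n; n≮0; n<1⇒n≡0)
open import Data.Fin using (Fin; _≟_)
open import Data.Fin.Subset using (Subset; ⊤; _∈_; _∉_; _⊆_; _∪_; _∩_; _─_; _-_; ⁅_⁆; ∣_∣; inside; outside)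
open import Data.Fin.Subset.Properties
  using (_∈?_; ⊆-refl; ⊆-reflexive; ⊆-antisym; x∈⁅x⁆; x∈⁅y⁆⇒x≡y; ∣⁅x⁆∣≡1; x∈p∪q⁺; x∈p∪q⁻; q⊆p∪q;
         x∈p∩q⁺; ∪-assoc; ∪-commutativeMonoid; p─q⊆p; ∣p─q∣≤∣p∣; x∈p∧x≢y⇒x∈p-y; p─x─y≡p─y─x;
         x∈p⇒∣p-x∣<∣p∣)
open import Data.Vec using ([]; _∷_; there)
open import Data.Vec.Properties using (lookup∘tabulate; lookup⇒[]=)
open import Data.Product using (Σ; ∃; _×_; _,_; proj₁; proj₂)
open import Data.Sum using (_⊎_; inj₁; inj₂; [_,_]′; map₂)
open import Data.Empty using (⊥-elim)
open import Function using (_∘_)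
open import Relation.Nullary using (¬_; Dec; yes; no)
open import Relation.Binary.PropositionalEquality using (_≡_; _≢_; refl; sym; trans; subst; subst₂)
open import Relation.Binary.Construct.Closure.ReflexiveTransitive using (Star; ε; _◅_; _◅◅_; gmap)
open import Algebra.Bundles using (CommutativeMonoid)
import Algebra.Properties.CommutativeSemigroup as CommutativeSemigroupProperties
open import Data.Star.Decoration using (EdgePred; All; ↦; mapAll; _◅◅◅_)

private
  variable
    n : ℕ

x∈p─q⇒x∉q : ∀ (p q : Subset n) {x} → x ∈ p ─ q → x ∉ q
x∈p─q⇒x∉q (_ ∷ p) (inside ∷ q)  (there x∈) (there x∈q) = x∈p─q⇒x∉q p q x∈ x∈q
x∈p─q⇒x∉q (_ ∷ p) (outside ∷ q) (there x∈) (there x∈q) = x∈p─q⇒x∉q p q x∈ x∈q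

x∈p-y⇒x≢y : ∀ {p : Subset n} {x y} → x ∈ p - y → x ≢ y
x∈p-y⇒x≢y {p = p} {y = y} x∈ refl = x∈p─q⇒x∉q p ⁅ y ⁆ x∈ (x∈⁅x⁆ y)

⁅x⁆⊆p : ∀ {p : Subset n} {x} → x ∈ p → ⁅ x ⁆ ⊆ p
⁅x⁆⊆p {x = x} x∈p y∈⁅x⁆ with x∈⁅y⁆⇒x≡y x y∈⁅x⁆
... | refl = x∈p

∪-⊆ : ∀ {p q r : Subset n} → p ⊆ r → q ⊆ r → p ∪ q ⊆ r
∪-⊆ {p = p} {q} p⊆r q⊆r x∈ = [ p⊆r , q⊆r ]′ (x∈p∪q⁻ p q x∈)

∣p∪q∣≤∣p∣+∣q∣ : ∀ (p q : Subset n) → ∣ p ∪ q ∣ ≤ ∣ p ∣ + ∣ q ∣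
∣p∪q∣≤∣p∣+∣q∣ []            []            = z≤n
∣p∪q∣≤∣p∣+∣q∣ (inside ∷ p)  (inside ∷ q)  = s≤s (≤-trans (∣p∪q∣≤∣p∣+∣q∣ p q) (+-monoʳ-≤ ∣ p ∣ (n≤1+n _)))
∣p∪q∣≤∣p∣+∣q∣ (inside ∷ p)  (outside ∷ q) = s≤s (∣p∪q∣≤∣p∣+∣q∣ p q)
∣p∪q∣≤∣p∣+∣q∣ (outside ∷ p) (inside ∷ q)  =
  subst (suc ∣ p ∪ q ∣ ≤_) (sym (+-suc ∣ p ∣ ∣ q ∣)) (s≤s (∣p∪q∣≤∣p∣+∣q∣ p q))
∣p∪q∣≤∣p∣+∣q∣ (outside ∷ p) (outside ∷ q) = ∣p∪q∣≤∣p∣+∣q∣ p q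

∣⁅x⁆∪p∣≤1+∣p∣ : ∀ (x : Fin n) (p : Subset n) → ∣ ⁅ x ⁆ ∪ p ∣ ≤ suc ∣ p ∣
∣⁅x⁆∪p∣≤1+∣p∣ x p = subst (λ k → ∣ ⁅ x ⁆ ∪ p ∣ ≤ k + ∣ p ∣) (∣⁅x⁆∣≡1 x) (∣p∪q∣≤∣p∣+∣q∣ ⁅ x ⁆ p)

module _ {p : Subset n} {x y : Fin n} where

  ∣p-x-y∣<∣p∣ˡ : x ∈ p → ∣ p - x - y ∣ < ∣ p ∣
  ∣p-x-y∣<∣p∣ˡ x∈p = ≤-<-trans (∣p─q∣≤∣p∣ (p - x) ⁅ y ⁆) (x∈p⇒∣p-x∣<∣p∣ x∈p)

  ∣p-x-y∣<∣p∣ʳ : y ∈ p → y ≢ x → ∣ p - x - y ∣ < ∣ p ∣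
  ∣p-x-y∣<∣p∣ʳ y∈p y≢x = <-≤-trans (x∈p⇒∣p-x∣<∣p∣ (x∈p∧x≢y⇒x∈p-y y∈p y≢x)) (∣p─q∣≤∣p∣ p ⁅ x ⁆)

  2+∣p-x-y∣≤∣p∣ : x ∈ p → y ∈ p → y ≢ x → 2 + ∣ p - x - y ∣ ≤ ∣ p ∣
  2+∣p-x-y∣≤∣p∣ x∈p y∈p y≢x = ≤-trans (s≤s (x∈p⇒∣p-x∣<∣p∣ (x∈p∧x≢y⇒x∈p-y y∈p y≢x))) (x∈p⇒∣p-x∣<∣p∣ x∈p)

module _ {W : Subset n} {u v x : Fin n} where

  ∈-delEdge⁻ : x ∈ delEdge W u v → x ∈ W × x ≢ u × x ≢ v
  ∈-delEdge⁻ x∈ = p─q⊆p W ⁅ u ⁆ x∈W-u , x∈p-y⇒x≢y x∈W-u , x∈p-y⇒x≢y x∈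
    where x∈W-u = p─q⊆p (W - u) ⁅ v ⁆ x∈

  ∈-delEdge⁺ : x ∈ W → x ≢ u → x ≢ v → x ∈ delEdge W u v
  ∈-delEdge⁺ x∈W x≢u x≢v = x∈p∧x≢y⇒x∈p-y (x∈p∧x≢y⇒x∈p-y x∈W x≢u) x≢v

module _ (G : Graph n) where

  Adj-sym : ∀ {x y} → Adj G x y → Adj G y x
  Adj-sym {x} {y} xy = trans (adjSym G y x) xy

  Adj-irrefl : ∀ {x y} → Adj G x y → x ≢ y
  Adj-irrefl {x} xx refl with trans (sym xx) (adjIrr G x)
  ... | ()

  Adj⇒∈nbhd : ∀ {x y} → Adj G x y → y ∈ nbhd G x
  Adj⇒∈nbhd {x} {y} xy = lookup⇒[]= y (nbhd G x) (trans (lookup∘tabulate (adj G x) y) xy)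

  deg≡1⇒unique-neighbour : ∀ {W u v w} → deg G W u ≡ 1 → v ∈ W → Adj G u v →
                           w ∈ W → Adj G u w → w ≡ v
  deg≡1⇒unique-neighbour {W} {u} {v} {w} deg≡1 v∈W uv w∈W uw with w ≟ v
  ... | yes w≡v = w≡v
  ... | no w≢v = ⊥-elim (n≮0 (subst (∣ N - v - w ∣ <_) ∣N-v∣≡0 ∣N-v-w∣<∣N-v∣))
    where
    N = nbhd G u ∩ W
    ∣N-v-w∣<∣N-v∣ : ∣ N - v - w ∣ < ∣ N - v ∣
    ∣N-v-w∣<∣N-v∣ = x∈p⇒∣p-x∣<∣p∣ (x∈p∧x≢y⇒x∈p-y (x∈p∩q⁺ (Adj⇒∈nbhd uw , w∈W)) w≢v)
    ∣N-v∣≡0 : ∣ N - v ∣ ≡ 0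
    ∣N-v∣≡0 = n<1⇒n≡0 (subst (∣ N - v ∣ <_) deg≡1 (x∈p⇒∣p-x∣<∣p∣ (x∈p∩q⁺ (Adj⇒∈nbhd uv , v∈W))))

record Leaf (G : Graph n) (W : Subset n) (u v : Fin n) : Set where
  constructor leaf
  field
    leaf∈  : u ∈ W
    stem∈  : v ∈ W
    edge   : Adj G u v
    unique : ∀ {w} → w ∈ W → Adj G u w → w ≡ v

pendent⇒leaf : ∀ {G : Graph n} {W u v} → PendentEdge G W u v → Leaf G W u v ⊎ Leaf G W v u
pendent⇒leaf {G = G} (u∈W , v∈W , uv , inj₁ deg-u≡1) =
  inj₁ (leaf u∈W v∈W uv (deg≡1⇒unique-neighbour G deg-u≡1 v∈W uv))
pendent⇒leaf {G = G} (u∈W , v∈W , uv , inj₂ deg-v≡1) =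
  inj₂ (leaf v∈W u∈W vu (deg≡1⇒unique-neighbour G deg-v≡1 u∈W vu))
  where vu = Adj-sym G uv

module _ {a ℓ p : Level} {I : Set a} {T : I → I → Set ℓ} where

  data FirstEdge (P : EdgePred p T) (i k : I) : Set (a ⊔ ℓ ⊔ p) where
    first : ∀ {j j'} (xs : Star T i j) → All (λ x → ¬ P x) xs →
            (x : T j j') → P x → (ys : Star T j' k) → FirstEdge P i k

  all-or-first : {P : EdgePred p T} → (∀ {i j} (x : T i j) → Dec (P x)) →
                 ∀ {i k} (xs : Star T i k) → All (λ x → ¬ P x) xs ⊎ FirstEdge P i k
  all-or-first P? ε = inj₁ ε
  all-or-first P? (x ◅ xs) with P? x
  ... | yes px = inj₂ (first ε ε x px xs)
  ... | no ¬px with all-or-first P? xs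
  ...   | inj₁ none = inj₁ (↦ ¬px ◅ none)
  ...   | inj₂ (first ys none y py zs) = inj₂ (first (x ◅ ys) (↦ ¬px ◅ none) y py zs)

module _ {G : Graph n} {W S : Subset n} where

  forcer : ∀ {C C'} → Force G W S C C' → Fin n
  forcer (force c _ _ _ _ _ _ _) = c

  target : ∀ {C C'} → Force G W S C C' → Fin n
  target (force _ x _ _ _ _ _ _) = x

  forcer-saturated : ∀ {C C' y} (f : Force G W S C C') → y ∈ W → Adj G (forcer f) y → y ∈ C'
  forcer-saturated {C = C} {y = y} (force c x _ _ _ _ _ uniq) y∈W cy with y ∈? C
  ... | yes y∈C = x∈p∪q⁺ (inj₂ y∈C)
  ... | no y∉C rewrite uniq y y∈W cy y∉C = x∈p∪q⁺ (inj₁ (x∈⁅x⁆ x))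

  saturated-never-forces : ∀ {v C E} → (∀ {y} → y ∈ W → Adj G v y → y ∈ C) →
                           (fs : Star (Force G W S) C E) → All (λ f → forcer f ≢ v) fs
  saturated-never-forces sat ε = ε
  saturated-never-forces {v} sat (force c x _ _ x∈W x∉C cx _ ◅ fs) =
    ↦ c≢v ◅ saturated-never-forces (λ y∈W vy → x∈p∪q⁺ (inj₂ (sat y∈W vy))) fs
    where
    c≢v : c ≢ v
    c≢v refl = x∉C (sat x∈W cx)

module _ {G : Graph n} {W W' S S' X : Subset n}
         (X∪W'≡W : X ∪ W' ≡ W) (X∉W' : ∀ {y} → y ∈ X → y ∉ W') (S'⊆S : S' ⊆ S) where

  lift-force : ∀ {D D'} → Force G W' S' D D' → Force G W S (X ∪ D) (X ∪ D')
  lift-force {D} (force c x c∈S' c∈D x∈W' x∉D cx uniq) =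
    subst (Force G W S (X ∪ D)) (x∙yz≈y∙xz ⁅ x ⁆ X D)
      (force c x (S'⊆S c∈S') (x∈p∪q⁺ (inj₂ c∈D)) x∈W x∉X∪D cx uniq')
    where
    open CommutativeSemigroupProperties (CommutativeMonoid.commutativeSemigroup (∪-commutativeMonoid _))
      using (x∙yz≈y∙xz)
    x∈W : x ∈ W
    x∈W = ⊆-reflexive X∪W'≡W (q⊆p∪q X W' x∈W')
    x∉X∪D : x ∉ X ∪ D
    x∉X∪D x∈ = [ (λ x∈X → X∉W' x∈X x∈W') , x∉D ]′ (x∈p∪q⁻ X D x∈)
    uniq' : ∀ w → w ∈ W → Adj G c w → w ∉ X ∪ D → w ≡ x
    uniq' w w∈W cw w∉X∪D with x∈p∪q⁻ X W' (⊆-reflexive (sym X∪W'≡W) w∈W)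
    ... | inj₁ w∈X  = ⊥-elim (w∉X∪D (x∈p∪q⁺ (inj₁ w∈X)))
    ... | inj₂ w∈W' = uniq w w∈W' cw (λ w∈D → w∉X∪D (x∈p∪q⁺ (inj₂ w∈D)))

Replayable : ∀ {G : Graph n} {W S C C'} (W' S' : Subset n) → Force G W S C C' → Set
Replayable W' S' f = target f ∈ W' → forcer f ∈ S' ⊎ target f ∈ S'

module _ {G : Graph n} {W W' S S' : Subset n} (W'⊆W : W' ⊆ W) where

  Tracks : Subset n → Subset n → Set
  Tracks C D = S' ⊆ D × D ⊆ W' × (∀ {y} → y ∈ W' → y ∈ C → y ∈ D)

  private
    tracks-skip : ∀ {x C D} → (x ∈ W' → x ∈ D) → Tracks C D → Tracks (⁅ x ⁆ ∪ C) D
    tracks-skip {x} {C} {D} x∈D (S'⊆D , D⊆W' , C⊆D) = S'⊆D , D⊆W' , covers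
      where
      covers : ∀ {y} → y ∈ W' → y ∈ ⁅ x ⁆ ∪ C → y ∈ D
      covers y∈W' y∈ with x∈p∪q⁻ ⁅ x ⁆ C y∈
      ... | inj₂ y∈C = C⊆D y∈W' y∈C
      ... | inj₁ y∈⁅x⁆ with x∈⁅y⁆⇒x≡y x y∈⁅x⁆
      ...   | refl = x∈D y∈W'

    tracks-force : ∀ {x C D} → x ∈ W' → Tracks C D → Tracks (⁅ x ⁆ ∪ C) (⁅ x ⁆ ∪ D)
    tracks-force {x} {C} {D} x∈W' (S'⊆D , D⊆W' , C⊆D) =
      q⊆p∪q ⁅ x ⁆ D ∘ S'⊆D ,
      ∪-⊆ (⁅x⁆⊆p x∈W') D⊆W' ,
      (λ y∈W' y∈ → x∈p∪q⁺ (map₂ (C⊆D y∈W') (x∈p∪q⁻ ⁅ x ⁆ C y∈)))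

  replay-force : ∀ {C C' D} (f : Force G W S C C') → Replayable W' S' f → Tracks C D →
                 ∃ λ D' → Star (Force G W' S') D D' × Tracks C' D'
  replay-force {D = D} (force c x _ _ _ _ cx uniq) replayable t@(S'⊆D , _ , C⊆D)
    with x ∈? W' | x ∈? D
  ... | no x∉W'  | _       = D , ε , tracks-skip (λ x∈W' → ⊥-elim (x∉W' x∈W')) t
  ... | yes _    | yes x∈D = D , ε , tracks-skip (λ _ → x∈D) t
  ... | yes x∈W' | no x∉D with replayable x∈W'
  ...   | inj₂ x∈S' = ⊥-elim (x∉D (S'⊆D x∈S'))
  ...   | inj₁ c∈S' = ⁅ x ⁆ ∪ D , force c x c∈S' (S'⊆D c∈S') x∈W' x∉D cx uniq' ◅ ε , tracks-force x∈W' t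
    where
    uniq' : ∀ w → w ∈ W' → Adj G c w → w ∉ D → w ≡ x
    uniq' w w∈W' cw w∉D = uniq w (W'⊆W w∈W') cw (λ w∈C → w∉D (C⊆D w∈W' w∈C))

  replay : ∀ {C E D} (fs : Star (Force G W S) C E) → All (Replayable W' S') fs → Tracks C D →
           ∃ λ D' → Star (Force G W' S') D D' × Tracks E D'
  replay ε ε t = _ , ε , t
  replay (f ◅ fs) (↦ r ◅ rs) t with replay-force f r t
  ... | _ , hs , t' with replay fs rs t'
  ...   | D' , hs' , t'' = D' , hs ◅◅ hs' , t''

  replay-czfs : S' ⊆ W' → (∀ {y} → y ∈ W' → y ∈ S → y ∈ S') →
                (fs : Star (Force G W S) S W) → All (Replayable W' S') fs → IsCZFS G W' S'
  replay-czfs S'⊆W' S⊆S' fs rs with replay fs rs (⊆-refl , S'⊆W' , S⊆S')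
  ... | D , hs , (_ , D⊆W' , W⊆D) = S'⊆W' , subst (Star (Force G W' S') S') D≡W' hs
    where
    D≡W' : D ≡ W'
    D≡W' = ⊆-antisym D⊆W' (λ y∈W' → W⊆D y∈W' (W'⊆W y∈W'))

module LeafDeletion {G : Graph n} {W : Subset n} {u v : Fin n} (L : Leaf G W u v) where
  open Leaf L

  W' : Subset n
  W' = delEdge W u v

  W'⊆W : W' ⊆ W
  W'⊆W = proj₁ ∘ ∈-delEdge⁻

  u∉W' : u ∉ W'
  u∉W' u∈W' = proj₁ (proj₂ (∈-delEdge⁻ u∈W')) refl

  v∉W' : v ∉ W'
  v∉W' v∈W' = proj₂ (proj₂ (∈-delEdge⁻ v∈W')) refl

  v≢u : v ≢ u
  v≢u = Adj-irrefl G (Adj-sym G edge)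

  private
    X : Subset n
    X = ⁅ v ⁆ ∪ ⁅ u ⁆

    X∪W'≡W : X ∪ W' ≡ W
    X∪W'≡W = ⊆-antisym (∪-⊆ (∪-⊆ (⁅x⁆⊆p stem∈) (⁅x⁆⊆p leaf∈)) W'⊆W) W⊆X∪W'
      where
      W⊆X∪W' : W ⊆ X ∪ W'
      W⊆X∪W' {y} y∈W with y ≟ v | y ≟ u
      ... | yes refl | _        = x∈p∪q⁺ (inj₁ (x∈p∪q⁺ (inj₁ (x∈⁅x⁆ v))))
      ... | no _     | yes refl = x∈p∪q⁺ (inj₁ (x∈p∪q⁺ (inj₂ (x∈⁅x⁆ u))))
      ... | no y≢v   | no y≢u   = x∈p∪q⁺ (inj₂ (∈-delEdge⁺ y∈W y≢u y≢v))

    X∉W' : ∀ {y} → y ∈ X → y ∉ W'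
    X∉W' y∈X with x∈p∪q⁻ ⁅ v ⁆ ⁅ u ⁆ y∈X
    ... | inj₁ y∈⁅v⁆ rewrite x∈⁅y⁆⇒x≡y v y∈⁅v⁆ = v∉W'
    ... | inj₂ y∈⁅u⁆ rewrite x∈⁅y⁆⇒x≡y u y∈⁅u⁆ = u∉W'

  extend : ∀ {S'} → IsCZFS G W' S' → IsCZFS G W (⁅ u ⁆ ∪ S')
  extend {S'} (S'⊆W' , fs) =
    ∪-⊆ (⁅x⁆⊆p leaf∈) (W'⊆W ∘ S'⊆W') ,
    leaf-forces-stem ◅ subst₂ (Star (Force G W S)) (∪-assoc ⁅ v ⁆ ⁅ u ⁆ S') X∪W'≡W
                         (gmap (X ∪_) (lift-force X∪W'≡W X∉W' (q⊆p∪q ⁅ u ⁆ S')) fs)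
    where
    S = ⁅ u ⁆ ∪ S'
    v∉S : v ∉ S
    v∉S v∈S = [ v≢u ∘ x∈⁅y⁆⇒x≡y u , v∉W' ∘ S'⊆W' ]′ (x∈p∪q⁻ ⁅ u ⁆ S' v∈S)
    leaf-forces-stem : Force G W S S (⁅ v ⁆ ∪ S)
    leaf-forces-stem = force u v u∈S u∈S stem∈ v∉S edge (λ _ w∈W uw _ → unique w∈W uw)
      where
      u∈S = x∈p∪q⁺ (inj₁ (x∈⁅x⁆ u))

  module _ {S : Subset n} (S⊆W : S ⊆ W) where

    private
      F : Subset n → Subset n → Set
      F = Force G W S

    core : Subset n
    core = delEdge S u v

    ∈-core : ∀ {y} → y ∈ W' → y ∈ S → y ∈ core
    ∈-core y∈W' y∈S with ∈-delEdge⁻ y∈W'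
    ... | _ , y≢u , y≢v = ∈-delEdge⁺ y∈S y≢u y≢v

    core⊆W' : core ⊆ W'
    core⊆W' y∈core with ∈-delEdge⁻ y∈core
    ... | y∈S , y≢u , y≢v = ∈-delEdge⁺ (S⊆W y∈S) y≢u y≢v

    leaf-forced-by-stem : ∀ {C E} (fs : Star F C E) → All (λ f → forcer f ≢ v) fs → u ∈ E → u ∈ C
    leaf-forced-by-stem ε ε u∈E = u∈E
    leaf-forced-by-stem {C} (force c x c∈S _ _ _ cx _ ◅ fs) (↦ c≢v ◅ rs) u∈E
      with x∈p∪q⁻ ⁅ x ⁆ C (leaf-forced-by-stem fs rs u∈E)
    ... | inj₂ u∈C = u∈C
    ... | inj₁ u∈⁅x⁆ with x∈⁅y⁆⇒x≡y x u∈⁅x⁆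
    ...   | refl = ⊥-elim (c≢v (unique (S⊆W c∈S) (Adj-sym G cx)))

    replayable-unless-by-stem : ∀ {S' C C'} → core ⊆ S' → (f : F C C') → forcer f ≢ v →
                                Replayable W' S' f
    replayable-unless-by-stem core⊆S' (force c x c∈S _ x∈W _ cx _) c≢v x∈W' with c ≟ u
    ... | yes refl = ⊥-elim (v∉W' (subst (_∈ W') (unique x∈W cx) x∈W'))
    ... | no c≢u   = inj₁ (core⊆S' (∈-delEdge⁺ c∈S c≢u c≢v))

    replay-czfs-core : ∀ {S'} → core ⊆ S' → S' ⊆ W' →
                       (fs : Star F S W) → All (Replayable W' S') fs → IsCZFS G W' S'
    replay-czfs-core core⊆S' S'⊆W' = replay-czfs W'⊆W S'⊆W' (λ y∈W' y∈S → core⊆S' (∈-core y∈W' y∈S))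

    all-replayable-unless-by-stem : ∀ {S' C E} {fs : Star F C E} → core ⊆ S' →
                                    All (λ f → forcer f ≢ v) fs → All (Replayable W' S') fs
    all-replayable-unless-by-stem core⊆S' = mapAll (λ {x = f} → replayable-unless-by-stem core⊆S' f)

    all-replayable-around-stem-force : ∀ {S' C D D' E} → core ⊆ S' →
      (fs : Star F C D) → All (λ f → forcer f ≢ v) fs →
      (f : F D D') → forcer f ≡ v → Replayable W' S' f →
      (fs' : Star F D' E) → All (Replayable W' S') (fs ◅◅ f ◅ fs')
    all-replayable-around-stem-force core⊆S' fs none f refl f-ok fs' =
      all-replayable-unless-by-stem core⊆S' none ◅◅◅
      ↦ f-ok ◅ all-replayable-unless-by-stem core⊆S' (saturated-never-forces (forcer-saturated f) fs')

    shrink : Star F S W → ∃ λ S' → IsCZFS G W' S' × suc ∣ S' ∣ ≤ ∣ S ∣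
    shrink fs with all-or-first (λ f → forcer f ≟ v) fs
    ... | inj₁ none =
      core ,
      replay-czfs-core ⊆-refl core⊆W' fs (all-replayable-unless-by-stem ⊆-refl none) ,
      ∣p-x-y∣<∣p∣ˡ (leaf-forced-by-stem fs none leaf∈)
    ... | inj₂ (first {j = C} fs₁ none f@(force _ w v∈S _ w∈W w∉C vw uniq) refl fs₂) with w ≟ u
    ...   | yes refl =
      core ,
      replay-czfs-core ⊆-refl core⊆W' _
        (all-replayable-around-stem-force ⊆-refl fs₁ none f refl (⊥-elim ∘ u∉W') fs₂) ,
      ∣p-x-y∣<∣p∣ʳ v∈S v≢u
    ...   | no w≢u =
      ⁅ w ⁆ ∪ core ,
      replay-czfs-core (q⊆p∪q ⁅ w ⁆ core) (∪-⊆ (⁅x⁆⊆p w∈W') core⊆W') _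
        (all-replayable-around-stem-force (q⊆p∪q ⁅ w ⁆ core) fs₁ none f refl w-initial fs₂) ,
      ≤-trans (s≤s (∣⁅x⁆∪p∣≤1+∣p∣ w core)) (2+∣p-x-y∣≤∣p∣ u∈S v∈S v≢u)
      where
      w∈W' : w ∈ W'
      w∈W' = ∈-delEdge⁺ w∈W w≢u (Adj-irrefl G vw ∘ sym)
      w-initial : Replayable W' (⁅ w ⁆ ∪ core) f
      w-initial _ = inj₂ (x∈p∪q⁺ (inj₁ (x∈⁅x⁆ w)))
      u∈C : u ∈ C
      u∈C with u ∈? C
      ... | yes u∈C = u∈C
      ... | no u∉C  = ⊥-elim (w≢u (sym (uniq u leaf∈ (Adj-sym G edge) u∉C)))
      u∈S : u ∈ S
      u∈S = leaf-forced-by-stem fs₁ none u∈C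

module _ {G : Graph n} {W : Subset n} {u v : Fin n} (uv : PendentEdge G W u v) where

  pendent-extend : ∀ {S'} → IsCZFS G (delEdge W u v) S' → ∃ λ S → IsCZFS G W S × ∣ S ∣ ≤ suc ∣ S' ∣
  pendent-extend {S'} czfs with pendent⇒leaf uv
  ... | inj₁ L = _ , LeafDeletion.extend L czfs , ∣⁅x⁆∪p∣≤1+∣p∣ u S'
  ... | inj₂ L = _ , LeafDeletion.extend L (subst (λ W' → IsCZFS G W' S') (p─x─y≡p─y─x W u v) czfs) ,
                 ∣⁅x⁆∪p∣≤1+∣p∣ v S'

  pendent-shrink : ∀ {S} → IsCZFS G W S → ∃ λ S' → IsCZFS G (delEdge W u v) S' × suc ∣ S' ∣ ≤ ∣ S ∣
  pendent-shrink (S⊆W , fs) with pendent⇒leaf uv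
  ... | inj₁ L = LeafDeletion.shrink L S⊆W fs
  ... | inj₂ L with LeafDeletion.shrink L S⊆W fs
  ...   | S' , czfs , lt = S' , subst (λ W' → IsCZFS G W' S') (p─x─y≡p─y─x W v u) czfs , lt

module _ {G : Graph n} where

  deletions-extend : ∀ {W k W' S'} → DeleteSeq G W k W' → IsCZFS G W' S' →
                     ∃ λ S → IsCZFS G W S × ∣ S ∣ ≤ ∣ S' ∣ + k
  deletions-extend {S' = S'} done czfs = S' , czfs , m≤m+n ∣ S' ∣ 0
  deletions-extend {k = suc k} {S' = S'} (step _ _ uv dels) czfs with deletions-extend dels czfs
  ... | S₁ , czfs₁ , ∣S₁∣≤ with pendent-extend uv czfs₁
  ...   | S , czfs₀ , ∣S∣≤ =
    S , czfs₀ , ≤-trans ∣S∣≤ (subst (suc ∣ S₁ ∣ ≤_) (sym (+-suc ∣ S' ∣ k)) (s≤s ∣S₁∣≤))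

  deletions-shrink : ∀ {W k W' S} → DeleteSeq G W k W' → IsCZFS G W S →
                     ∃ λ S' → IsCZFS G W' S' × ∣ S' ∣ + k ≤ ∣ S ∣
  deletions-shrink {S = S} done czfs = S , czfs , ≤-reflexive (+-identityʳ ∣ S ∣)
  deletions-shrink {k = suc k} {S = S} (step _ _ uv dels) czfs with pendent-shrink uv czfs
  ... | S₁ , czfs₁ , ∣S₁∣< with deletions-shrink dels czfs₁
  ...   | S' , czfs' , ∣S'∣+k≤ =
    S' , czfs' , subst (_≤ ∣ S ∣) (sym (+-suc ∣ S' ∣ k)) (≤-trans (s≤s ∣S'∣+k≤) ∣S₁∣<)

mainTheorem11 : ∀ {n} (G : Graph n) →
    Σ (Fin n) (λ u → Σ (Fin n) (λ v → PendentEdge G ⊤ u v)) →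
    ∀ (k : ℕ) (W : Subset n) → DeleteSeq G ⊤ k W →
    ∀ (m m' : ℕ) → CzfIs G ⊤ m → CzfIs G W m' → m ≡ m' + k
mainTheorem11 G _ k W dels m m' ((S , czfs , refl) , minimal) ((S' , czfs' , refl) , minimal') =
  ≤-antisym m≤m'+k m'+k≤m
  where
  m≤m'+k : ∣ S ∣ ≤ ∣ S' ∣ + k
  m≤m'+k with deletions-extend dels czfs'
  ... | T , czfsT , ∣T∣≤ = ≤-trans (minimal T czfsT) ∣T∣≤
  m'+k≤m : ∣ S' ∣ + k ≤ ∣ S ∣
  m'+k≤m with deletions-shrink dels czfs
  ... | T , czfsT , ∣T∣+k≤ = ≤-trans (+-monoˡ-≤ k (minimal' T czfsT)) ∣T∣+k≤
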